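{- Let $\mathcal{Y}$ be the affine Yangian of $\mathfrak{gl}(1)$ and let $\diamondsuit=\{\mathrm{ad}_{e_1}^{n-1}e_0 : n=1,2,3,\dots\}\subset\mathcal{Y}$. If $A\in\mathcal{Y}$ commutes with every element of $\diamondsuit$, then for every $n=1,2,3,\dots$ the element $\mathrm{ad}_{e_1}^{n-1}A$ commutes with every element of $\diamondsuit$.
   Context: Let $h_1,h_2,h_3\in\mathbb{C}$ with $h_1+h_2+h_3=0$, and put $\sigma_2=h_1h_2+h_1h_3+h_2h_3$, $\sigma_3=h_1h_2h_3$. The affine Yangian $\mathcal{Y}$ of $\mathfrak{gl}(1)$ is the associative algebra with generators $e_j,f_j,\psi_j$ ($j=0,1,2,\dots$), with $\psi_0=1$, subject to: $[\psi_j,\psi_k]=0$; $[e_j,f_k]=\psi_{j+k}$; $[e_{j+3},e_k]-3[e_{j+2},e_{k+1}]+3[e_{j+1},e_{k+2}]-[e_j,e_{k+3}]+\sigma_2[e_{j+1},e_k]-\sigma_2[e_j,e_{k+1}]-\sigma_3\{e_j,e_k\}=0$; the same relation with $e$ replaced by $f$ and $-\sigma_3$ replaced by $+\sigma_3$; the relation obtained from the $e$-relation by replacing the first entry of each bracket by $\psi$ and likewise for $f$ with $+\sigma_3$; $[\psi_0,e_j]=[\psi_1,e_j]=0$, $[\psi_2,e_j]=2e_j$, $[\psi_0,f_j]=[\psi_1,f_j]=0$, $[\psi_2,f_j]=-2f_j$; and $\mathrm{Sym}_{(j_1,j_2,j_3)}[e_{j_1},[e_{j_2},e_{j_3+1}]]=0$,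 $\mathrm{Sym}_{(j_1,j_2,j_3)}[f_{j_1},[f_{j_2},f_{j_3+1}]]=0$, where Sym is the sum over the 6 permutations of $(j_1,j_2,j_3)$. Here $[x,y]=xy-yx$, $\{x,y\}=xy+yx$, $\mathrm{ad}_x(y)=[x,y]$, and $\mathrm{ad}_x^0$ is the identity. -}

module Defs where

open import Level using (_⊔_; suc)
open import Algebra.Bundles using (Ring)
open import Data.Nat using (ℕ; zero; suc) renaming (_+_ to _+ℕ_)

module RingNotation {c ℓ} (R : Ring c ℓ) where
  open Ring R

  comm : Carrier → Carrier → Carrier
  comm x y = x * y - y * x

  anti : Carrier → Carrier → Carrier
  anti x y = x * y + y * x

  ad : Carrier → Carrier → Carrier
  ad x y = comm x y

  adPow : Carrier → ℕ → Carrier → Carrier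
  adPow x zero    y = y
  adPow x (suc n) y = ad x (adPow x n y)

  sig2 sig3 : Carrier → Carrier → Carrier → Carrier
  sig2 a b d = a * b + a * d + b * d
  sig3 a b d = a * b * d

  two three : Carrier
  two   = 1# + 1#
  three = 1# + 1# + 1#

  -- left-hand side of the cubic relation, with first-slot family X,
  -- second-slot family Y, and sign-carrying coefficient s of {X_j,Y_k}:
  -- [X_{j+3},Y_k] - 3[X_{j+2},Y_{k+1}] + 3[X_{j+1},Y_{k+2}] - [X_j,Y_{k+3}]
  --   + σ₂[X_{j+1},Y_k] - σ₂[X_j,Y_{k+1}] + s{X_j,Y_k}
  cubicRel : Carrier → (ℕ → Carrier) → (ℕ → Carrier) → Carrier → ℕ → ℕ → Carrier
  cubicRel σ₂ X Y s j k =
    comm (X (j +ℕ 3)) (Y k)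
    - three * comm (X (j +ℕ 2)) (Y (k +ℕ 1))
    + three * comm (X (j +ℕ 1)) (Y (k +ℕ 2))
    - comm (X j) (Y (k +ℕ 3))
    + σ₂ * comm (X (j +ℕ 1)) (Y k)
    - σ₂ * comm (X j) (Y (k +ℕ 1))
    + s * anti (X j) (Y k)

  sym3 : (ℕ → ℕ → ℕ → Carrier) → ℕ → ℕ → ℕ → Carrier
  sym3 g a b d = g a b d + g a d b + g b a d + g b d a + g d a b + g d b a

-- An algebra R together with central scalars h₁,h₂,h₃ (h₁+h₂+h₃=0) and
-- elements e_j, f_j, ψ_j satisfying all defining relations of the affine
-- Yangian of gl(1); i.e. R receives a homomorphism from 𝒴 (the universal
-- such R is 𝒴 itself).
record AffineYangianGL1 {c ℓ} (R : Ring c ℓ) : Set (c ⊔ ℓ) where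
  open Ring R
  open RingNotation R
  field
    h₁ h₂ h₃ : Carrier
    h₁-central : ∀ x → h₁ * x ≈ x * h₁
    h₂-central : ∀ x → h₂ * x ≈ x * h₂
    h₃-central : ∀ x → h₃ * x ≈ x * h₃
    h-sum : h₁ + h₂ + h₃ ≈ 0#
    e f ψ : ℕ → Carrier
    ψ₀≈1   : ψ 0 ≈ 1#
    ψψ     : ∀ j k → comm (ψ j) (ψ k) ≈ 0#
    ef     : ∀ j k → comm (e j) (f k) ≈ ψ (j +ℕ k)
    ee     : ∀ j k → cubicRel (sig2 h₁ h₂ h₃) e e (- sig3 h₁ h₂ h₃) j k ≈ 0#
    ff     : ∀ j k → cubicRel (sig2 h₁ h₂ h₃) f f (sig3 h₁ h₂ h₃) j k ≈ 0#
    ψe     : ∀ j k → cubicRel (sig2 h₁ h₂ h₃) ψ e (- sig3 h₁ h₂ h₃) j k ≈ 0#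
    ψf     : ∀ j k → cubicRel (sig2 h₁ h₂ h₃) ψ f (sig3 h₁ h₂ h₃) j k ≈ 0#
    ψ₀e    : ∀ j → comm (ψ 0) (e j) ≈ 0#
    ψ₁e    : ∀ j → comm (ψ 1) (e j) ≈ 0#
    ψ₂e    : ∀ j → comm (ψ 2) (e j) ≈ two * e j
    ψ₀f    : ∀ j → comm (ψ 0) (f j) ≈ 0#
    ψ₁f    : ∀ j → comm (ψ 1) (f j) ≈ 0#
    ψ₂f    : ∀ j → comm (ψ 2) (f j) ≈ - (two * f j)
    serreE : ∀ a b d → sym3 (λ x y z → comm (e x) (comm (e y) (e (z +ℕ 1)))) a b d ≈ 0#
    serreF : ∀ a b d → sym3 (λ x y z → comm (f x) (comm (f y) (f (z +ℕ 1)))) a b d ≈ 0#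

-- ad_x is a derivation, so if X commutes with both D and [x,D] then
-- [x,X]D = [x,XD] - X[x,D] = [x,DX] - [x,D]X = D[x,X].  Induction on n,
-- applied simultaneously to all m, then moves the hypothesis from A to
-- ad_{e₁}^n A: ad^n A commutes with ad^m e₀ and ad^{m+1} e₀, hence ad^{n+1} A
-- commutes with ad^m e₀.  No relation of the Yangian is needed; the
-- statement holds for any two elements of any ring.
module Submission where

open import Defs
open import Algebra.Bundles using (Ring)
open import Data.Nat using (ℕ; zero; suc)

module Commutators {c ℓ} (R : Ring c ℓ) where
  open Ring R
  open RingNotation R
  open import Algebra.Properties.Ring R
  open import Relation.Binary.Reasoning.Setoid setoid

  [p-q]+[q-r]≈p-r : ∀ p q r → (p - q) + (q - r) ≈ p - r
  [p-q]+[q-r]≈p-r p q r = begin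
    (p - q) + (q - r)    ≈⟨ +-assoc p (- q) (q - r) ⟩
    p + (- q + (q - r))  ≈⟨ +-congˡ (+-assoc (- q) q (- r)) ⟨
    p + ((- q + q) - r)  ≈⟨ +-congˡ (+-congʳ (-‿inverseˡ q)) ⟩
    p + (0# - r)         ≈⟨ +-congˡ (+-identityˡ (- r)) ⟩
    p - r                ∎

  ad-congʳ : ∀ x {y z} → y ≈ z → ad x y ≈ ad x z
  ad-congʳ x y≈z = +-cong (*-congˡ y≈z) (-‿cong (*-congʳ y≈z))

  ad-leibniz : ∀ x y z → ad x (y * z) ≈ ad x y * z + y * ad x z
  ad-leibniz x y z = begin
    x * (y * z) - y * z * x
      ≈⟨ +-cong (sym (*-assoc x y z)) (-‿cong (*-assoc y z x)) ⟩
    x * y * z - y * (z * x)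
      ≈⟨ [p-q]+[q-r]≈p-r (x * y * z) (y * (x * z)) (y * (z * x)) ⟨
    (x * y * z - y * (x * z)) + (y * (x * z) - y * (z * x))
      ≈⟨ +-congʳ (+-congˡ (-‿cong (*-assoc y x z))) ⟨
    (x * y * z - y * x * z) + (y * (x * z) - y * (z * x))
      ≈⟨ +-cong ([y-z]x≈yx-zx z (x * y) (y * x)) (x[y-z]≈xy-xz y (x * z) (z * x)) ⟨
    ad x y * z + y * ad x z ∎

  ad-preserves-commuting : ∀ x X D → X * D ≈ D * X → X * ad x D ≈ ad x D * X →
                           ad x X * D ≈ D * ad x X
  ad-preserves-commuting x X D XD≈DX X[x,D]≈[x,D]X = begin
    ad x X * D                              ≈⟨ //-rightDividesʳ (X * ad x D) (ad x X * D) ⟨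
    (ad x X * D + X * ad x D) - X * ad x D  ≈⟨ +-congʳ (ad-leibniz x X D) ⟨
    ad x (X * D) - X * ad x D               ≈⟨ +-cong (ad-congʳ x XD≈DX) (-‿cong X[x,D]≈[x,D]X) ⟩
    ad x (D * X) - ad x D * X               ≈⟨ +-congʳ (ad-leibniz x D X) ⟩
    (ad x D * X + D * ad x X) - ad x D * X  ≈⟨ +-congʳ (+-comm (ad x D * X) (D * ad x X)) ⟩
    (D * ad x X + ad x D * X) - ad x D * X  ≈⟨ //-rightDividesʳ (ad x D * X) (D * ad x X) ⟩
    D * ad x X                              ∎

  adPow-preserves-commuting :
    ∀ x d A → (∀ m → A * adPow x m d ≈ adPow x m d * A) →
    ∀ n m → adPow x n A * adPow x m d ≈ adPow x m d * adPow x n A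
  adPow-preserves-commuting x d A commutes zero    m = commutes m
  adPow-preserves-commuting x d A commutes (suc n) m =
    ad-preserves-commuting x (adPow x n A) (adPow x m d)
      (adPow-preserves-commuting x d A commutes n m)
      (adPow-preserves-commuting x d A commutes n (suc m))

mainTheorem2 : ∀ {c ℓ} (R : Ring c ℓ) (Y : AffineYangianGL1 R) →
    let open Ring R
        open RingNotation R
        open AffineYangianGL1 Y
    in (A : Carrier) →
       (∀ (m : ℕ) → A * adPow (e 1) m (e 0) ≈ adPow (e 1) m (e 0) * A) →
       ∀ (n m : ℕ) →
         adPow (e 1) n A * adPow (e 1) m (e 0) ≈ adPow (e 1) m (e 0) * adPow (e 1) n A
mainTheorem2 R Y = Commutators.adPow-preserves-commuting R (e 1) (e 0)
  where open AffineYangianGL1 Y
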